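{- For all integers $s\ge 2$ and $d\ge 2$ with $d\ge 2s$, we have $$c_{s,s}(Q_d)\le\left\lceil\frac{d-2s+3}{2}\right\rceil.$$
   Context: All graphs are finite, undirected and reflexive. $Q_d$ is the $d$-dimensional hypercube, the $d$-fold Cartesian product of $K_2$. In the speed-$(s,s)$ Cops and Robbers game on a graph $G$, the cops first place themselves on vertices, then the robber places himself; play proceeds in rounds, each a cops' turn followed by a robber's turn. On the cops' turn each cop moves along a walk of length at most $s$ (possibly staying put); on the robber's turn he moves along a walk of length at most $s$ not passing through a cop-occupied vertex. The cops win if some cop occupies the robber's vertex; the robber wins if he evades forever. $c_{s,s}(G)$ is the minimum number of cops guaranteeing a win. -}

module Defs where

open import Level using (0ℓ)
open import Data.Nat using (ℕ; zero; suc; _≤_)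
open import Data.Bool using (Bool; not)
open import Data.Fin using (Fin)
open import Data.Vec using (Vec; _[_]%=_)
open import Data.Vec.Membership.Propositional using (_∈_)
open import Data.Vec.Relation.Binary.Pointwise.Inductive using (Pointwise)
open import Data.Product using (Σ; ∃; _×_)
open import Data.Sum using (_⊎_)
open import Data.Unit using (⊤)
open import Relation.Binary.PropositionalEquality using (_≡_)
open import Relation.Nullary using (¬_)

-- A finite undirected graph, given by its vertex type and (symmetric) edge relation.
-- The graph is treated as reflexive: every vertex carries a loop (see Step).
record Graph : Set₁ where
  field
    V   : Set
    Adj : V → V → Set

Q : ℕ → Graph
Q d = record
  { V   = Vec Bool d
  ; Adj = λ u v → ∃ λ (i : Fin d) → v ≡ (u [ i ]%= not)
  }

module Game (G : Graph) where
  open Graph G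

  Step : V → V → Set
  Step u v = u ≡ v ⊎ Adj u v

  -- Walk P n u w : a walk from u to w of length at most n, every vertex
  -- entered along the way satisfying P
  data Walk (P : V → Set) : ℕ → V → V → Set where
    stop : ∀ {n u} → Walk P n u u
    step : ∀ {n u v w} → Step u v → P v → Walk P n v w → Walk P (suc n) u w

  Cops : ℕ → Set
  Cops k = Vec V k

  Caught : ∀ {k} → Cops k → V → Set
  Caught C r = r ∈ C

  CopMove : ℕ → ∀ {k} → Cops k → Cops k → Set
  CopMove s C C' = Pointwise (Walk (λ _ → ⊤) s) C C'

  RobberMove : ℕ → ∀ {k} → Cops k → V → V → Set
  RobberMove s C r r' = Walk (λ v → ¬ (v ∈ C)) s r r'

  -- CopWin s C r : in the speed-(s,s) game, with cops at C, robber at r and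
  -- the cops to move, the cops can force capture (in finitely many rounds).
  data CopWin (s : ℕ) {k : ℕ} : Cops k → V → Set where
    round : ∀ {C r} (C' : Cops k) → CopMove s C C' →
            (Caught C' r ⊎ (∀ r' → RobberMove s C' r r' → CopWin s C' r')) →
            CopWin s C r

  CopsWin : ℕ → ℕ → Set
  CopsWin s k = Σ (Cops k) λ C → ∀ r → Caught C r ⊎ CopWin s C r

CopNumberLE : Graph → ℕ → ℕ → Set
CopNumberLE G s k = ∃ λ m → m ≤ k × Game.CopsWin G s m

module Submission where

-- Write d = 2m + a with a ≤ 2s + 1 and cover the coordinates by a block A of a coordinates
-- and m pairs. Two cops, the twins, agree off A and are antipodal on A; every pair has a guard.
-- The twins' distances to the robber on A add up to ∣ A ∣ ≤ 2s + 1, so while he is out of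
-- reach of both they still differ from him off A, and chasing him there at full speed brings
-- them strictly closer to him off A unless he has changed a coordinate off A. A guard chases
-- the robber's antipode within its pair (off the pair at full speed, inside it with the speed
-- left); 3 × (distance off the pair) + (distance to the antipode inside it) never grows, and it
-- drops when the robber, staying out of reach, changes a coordinate of the pair. Since every
-- coordinate off A lies in a pair, the sum of these potentials falls every round until some
-- cop can reach the robber.

open import Defs
open import Data.Nat using (ℕ; _≤_; _+_; _*_; _∸_; ⌈_/2⌉)

open import Data.Bool using (Bool; true; false; not; _xor_)
open import Data.Bool.Properties using (not-involutive)
open import Data.Empty using (⊥-elim)
open import Data.Fin using (zero; suc)
open import Data.Fin.Subset using (Subset; inside; outside; ⊤; ⊥; ∁; ∣_∣; _∈_)
open import Data.Fin.Subset.Properties using (∈⊤; ∣⊤∣≡n; ∣⊥∣≡0; x∈p⇒x∉∁p)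
open import Data.Nat using (zero; suc; _<_; _⊓_; ⌊_/2⌋; z≤n; s≤s; s≤s⁻¹)
open import Data.Nat.Properties
open import Algebra.Properties.CommutativeSemigroup +-commutativeSemigroup using (interchange; x∙yz≈y∙xz)
open import Data.Nat.Tactic.RingSolver using (solve-∀)
open import Data.Product using (∃; _×_; _,_; proj₁; proj₂)
open import Data.Sum using (_⊎_; inj₁; inj₂)
import Data.Unit as Unit
open import Data.Vec using (Vec; []; _∷_; here; there; lookup; replicate; map; zipWith; sum; _[_]%=_)
open import Data.Vec.Relation.Binary.Pointwise.Inductive as Pointwise using ([]; _∷_)
open import Data.Vec.Relation.Unary.All using (All; []; _∷_)
import Data.Vec.Relation.Unary.All.Properties as Allₚ
open import Data.Vec.Relation.Unary.Any as Any using (Any; here; there)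
import Data.Vec.Relation.Unary.Any.Properties as Anyₚ
open import Function using (_∘_)
open import Relation.Binary.PropositionalEquality
open import Relation.Nullary using (¬_; Dec; yes; no)

private
  variable
    k n : ℕ

bitDistance : Bool → Bool → ℕ
bitDistance false false = 0
bitDistance true  true  = 0
bitDistance false true  = 1
bitDistance true  false = 1

bitDistance-self : ∀ x → bitDistance x x ≡ 0
bitDistance-self false = refl
bitDistance-self true  = refl

bitDistance-sym : ∀ x y → bitDistance x y ≡ bitDistance y x
bitDistance-sym false false = refl
bitDistance-sym false true  = refl
bitDistance-sym true  false = refl
bitDistance-sym true  true  = refl

bitDistance-triangle : ∀ x y z → bitDistance x z ≤ bitDistance x y + bitDistance y z
bitDistance-triangle false false z     = ≤-refl
bitDistance-triangle true  true  z     = ≤-refl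
bitDistance-triangle false true  false = z≤n
bitDistance-triangle false true  true  = s≤s z≤n
bitDistance-triangle true  false false = s≤s z≤n
bitDistance-triangle true  false true  = z≤n

bitDistance-not : ∀ x y → bitDistance (not x) (not y) ≡ bitDistance x y
bitDistance-not false false = refl
bitDistance-not false true  = refl
bitDistance-not true  false = refl
bitDistance-not true  true  = refl

bitDistance+bitDistance-not : ∀ x y → bitDistance x y + bitDistance x (not y) ≡ 1
bitDistance+bitDistance-not false false = refl
bitDistance+bitDistance-not false true  = refl
bitDistance+bitDistance-not true  false = refl
bitDistance+bitDistance-not true  true  = refl

distOn : Subset n → Vec Bool n → Vec Bool n → ℕ
distOn []            []       []       = 0
distOn (outside ∷ M) (_ ∷ xs) (_ ∷ ys) = distOn M xs ys
distOn (inside  ∷ M) (x ∷ xs) (y ∷ ys) = bitDistance x y + distOn M xs ys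

hamming : Vec Bool n → Vec Bool n → ℕ
hamming = distOn ⊤

flipOn : Subset n → Vec Bool n → Vec Bool n
flipOn = zipWith _xor_

approachOn : Subset n → ℕ → Vec Bool n → Vec Bool n → Vec Bool n
approachOn _             zero    c        _        = c
approachOn []            (suc b) []       []       = []
approachOn (outside ∷ M) (suc b) (x ∷ xs) (_ ∷ ys) = x ∷ approachOn M (suc b) xs ys
approachOn (inside  ∷ M) (suc b) (x ∷ xs) (y ∷ ys) = y ∷ approachOn M (suc b ∸ bitDistance x y) xs ys

∁-involutive : (M : Subset n) → ∁ (∁ M) ≡ M
∁-involutive []      = refl
∁-involutive (m ∷ M) = cong₂ _∷_ (not-involutive m) (∁-involutive M)

distOn-self : ∀ (M : Subset n) x → distOn M x x ≡ 0
distOn-self []            []       = refl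
distOn-self (outside ∷ M) (x ∷ xs) = distOn-self M xs
distOn-self (inside  ∷ M) (x ∷ xs) = cong₂ _+_ (bitDistance-self x) (distOn-self M xs)

distOn-sym : ∀ (M : Subset n) x y → distOn M x y ≡ distOn M y x
distOn-sym []            []       []       = refl
distOn-sym (outside ∷ M) (x ∷ xs) (y ∷ ys) = distOn-sym M xs ys
distOn-sym (inside  ∷ M) (x ∷ xs) (y ∷ ys) = cong₂ _+_ (bitDistance-sym x y) (distOn-sym M xs ys)

distOn-triangle : ∀ (M : Subset n) x y z → distOn M x z ≤ distOn M x y + distOn M y z
distOn-triangle []            []       []       []       = z≤n
distOn-triangle (outside ∷ M) (x ∷ xs) (y ∷ ys) (z ∷ zs) = distOn-triangle M xs ys zs
distOn-triangle (inside  ∷ M) (x ∷ xs) (y ∷ ys) (z ∷ zs) = begin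
  bitDistance x z + distOn M xs zs
    ≤⟨ +-mono-≤ (bitDistance-triangle x y z) (distOn-triangle M xs ys zs) ⟩
  (bitDistance x y + bitDistance y z) + (distOn M xs ys + distOn M ys zs)
    ≡⟨ interchange (bitDistance x y) _ _ _ ⟩
  (bitDistance x y + distOn M xs ys) + (bitDistance y z + distOn M ys zs) ∎
  where open ≤-Reasoning

hamming-split : ∀ (M : Subset n) x y → hamming x y ≡ distOn M x y + distOn (∁ M) x y
hamming-split []            []       []       = refl
hamming-split (outside ∷ M) (x ∷ xs) (y ∷ ys) = begin
  bitDistance x y + hamming xs ys
    ≡⟨ cong (bitDistance x y +_) (hamming-split M xs ys) ⟩
  bitDistance x y + (distOn M xs ys + distOn (∁ M) xs ys)
    ≡⟨ x∙yz≈y∙xz (bitDistance x y) (distOn M xs ys) _ ⟩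
  distOn M xs ys + (bitDistance x y + distOn (∁ M) xs ys) ∎
  where open ≡-Reasoning
hamming-split (inside ∷ M) (x ∷ xs) (y ∷ ys) =
  trans (cong (bitDistance x y +_) (hamming-split M xs ys)) (sym (+-assoc (bitDistance x y) _ _))

distOn-flipOn-flipOn : ∀ (N M : Subset n) x y → distOn N (flipOn M x) (flipOn M y) ≡ distOn N x y
distOn-flipOn-flipOn []            []            []       []       = refl
distOn-flipOn-flipOn (outside ∷ N) (_       ∷ M) (x ∷ xs) (y ∷ ys) = distOn-flipOn-flipOn N M xs ys
distOn-flipOn-flipOn (inside  ∷ N) (outside ∷ M) (x ∷ xs) (y ∷ ys) =
  cong (bitDistance x y +_) (distOn-flipOn-flipOn N M xs ys)
distOn-flipOn-flipOn (inside  ∷ N) (inside  ∷ M) (x ∷ xs) (y ∷ ys) =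
  cong₂ _+_ (bitDistance-not x y) (distOn-flipOn-flipOn N M xs ys)

distOn-∁-flipOn : ∀ (M : Subset n) x y → distOn (∁ M) x (flipOn M y) ≡ distOn (∁ M) x y
distOn-∁-flipOn []            []       []       = refl
distOn-∁-flipOn (outside ∷ M) (x ∷ xs) (y ∷ ys) = cong (bitDistance x y +_) (distOn-∁-flipOn M xs ys)
distOn-∁-flipOn (inside  ∷ M) (x ∷ xs) (y ∷ ys) = distOn-∁-flipOn M xs ys

distOn+distOn-flipOn : ∀ (M : Subset n) x y → distOn M x y + distOn M x (flipOn M y) ≡ ∣ M ∣
distOn+distOn-flipOn []            []       []       = refl
distOn+distOn-flipOn (outside ∷ M) (x ∷ xs) (y ∷ ys) = distOn+distOn-flipOn M xs ys
distOn+distOn-flipOn (inside  ∷ M) (x ∷ xs) (y ∷ ys) = begin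
  (bitDistance x y + distOn M xs ys) + (bitDistance x (not y) + distOn M xs (flipOn M ys))
    ≡⟨ interchange (bitDistance x y) _ _ _ ⟩
  (bitDistance x y + bitDistance x (not y)) + (distOn M xs ys + distOn M xs (flipOn M ys))
    ≡⟨ cong₂ _+_ (bitDistance+bitDistance-not x y) (distOn+distOn-flipOn M xs ys) ⟩
  suc ∣ M ∣ ∎
  where open ≡-Reasoning

distOn-approachOn : ∀ (M : Subset n) b c g → distOn M (approachOn M b c g) g ≡ distOn M c g ∸ b
distOn-approachOn _             zero    c            g            = refl
distOn-approachOn []            (suc b) []           []           = refl
distOn-approachOn (outside ∷ M) (suc b) (x     ∷ xs) (y     ∷ ys) = distOn-approachOn M (suc b) xs ys
distOn-approachOn (inside  ∷ M) (suc b) (false ∷ xs) (false ∷ ys) = distOn-approachOn M (suc b) xs ys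
distOn-approachOn (inside  ∷ M) (suc b) (true  ∷ xs) (true  ∷ ys) = distOn-approachOn M (suc b) xs ys
distOn-approachOn (inside  ∷ M) (suc b) (false ∷ xs) (true  ∷ ys) = distOn-approachOn M b xs ys
distOn-approachOn (inside  ∷ M) (suc b) (true  ∷ xs) (false ∷ ys) = distOn-approachOn M b xs ys

distOn-∁-approachOn : ∀ (M : Subset n) b c g z → distOn (∁ M) (approachOn M b c g) z ≡ distOn (∁ M) c z
distOn-∁-approachOn _             zero    c        g        z        = refl
distOn-∁-approachOn []            (suc b) []       []       []       = refl
distOn-∁-approachOn (outside ∷ M) (suc b) (x ∷ xs) (y ∷ ys) (z ∷ zs) =
  cong (bitDistance x z +_) (distOn-∁-approachOn M (suc b) xs ys zs)
distOn-∁-approachOn (inside  ∷ M) (suc b) (x ∷ xs) (y ∷ ys) (z ∷ zs) = distOn-∁-approachOn M _ xs ys zs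

distOn-approachOn-∁ : ∀ (M : Subset n) b c g z → distOn M (approachOn (∁ M) b c g) z ≡ distOn M c z
distOn-approachOn-∁ M b c g z =
  subst (λ N → distOn N (approachOn (∁ M) b c g) z ≡ distOn N c z) (∁-involutive M)
        (distOn-∁-approachOn (∁ M) b c g z)

hamming-approachOn : ∀ (M : Subset n) b c g → hamming c (approachOn M b c g) ≡ b ⊓ distOn M c g
hamming-approachOn _             zero    c            g            = distOn-self ⊤ c
hamming-approachOn []            (suc b) []           []           = refl
hamming-approachOn (outside ∷ M) (suc b) (x     ∷ xs) (y     ∷ ys) =
  trans (cong (_+ _) (bitDistance-self x)) (hamming-approachOn M (suc b) xs ys)
hamming-approachOn (inside  ∷ M) (suc b) (false ∷ xs) (false ∷ ys) = hamming-approachOn M (suc b) xs ys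
hamming-approachOn (inside  ∷ M) (suc b) (true  ∷ xs) (true  ∷ ys) = hamming-approachOn M (suc b) xs ys
hamming-approachOn (inside  ∷ M) (suc b) (false ∷ xs) (true  ∷ ys) = cong suc (hamming-approachOn M b xs ys)
hamming-approachOn (inside  ∷ M) (suc b) (true  ∷ xs) (false ∷ ys) = cong suc (hamming-approachOn M b xs ys)

distOn-pos⇒differ : ∀ (M : Subset n) x y → 0 < distOn M x y → ∃ λ i → i ∈ M × lookup x i ≢ lookup y i
distOn-pos⇒differ []            []          []          ()
distOn-pos⇒differ (outside ∷ M) (_     ∷ xs) (_     ∷ ys) d>0 with distOn-pos⇒differ M xs ys d>0
... | i , i∈M , differ = suc i , there i∈M , differ
distOn-pos⇒differ (inside  ∷ M) (false ∷ xs) (false ∷ ys) d>0 with distOn-pos⇒differ M xs ys d>0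
... | i , i∈M , differ = suc i , there i∈M , differ
distOn-pos⇒differ (inside  ∷ M) (true  ∷ xs) (true  ∷ ys) d>0 with distOn-pos⇒differ M xs ys d>0
... | i , i∈M , differ = suc i , there i∈M , differ
distOn-pos⇒differ (inside  ∷ M) (false ∷ xs) (true  ∷ ys) _ = zero , here , λ ()
distOn-pos⇒differ (inside  ∷ M) (true  ∷ xs) (false ∷ ys) _ = zero , here , λ ()

differ⇒distOn-pos : ∀ {M : Subset n} {i} x y → i ∈ M → lookup x i ≢ lookup y i → 0 < distOn M x y
differ⇒distOn-pos (false ∷ xs) (false ∷ ys) here differ = ⊥-elim (differ refl)
differ⇒distOn-pos (true  ∷ xs) (true  ∷ ys) here differ = ⊥-elim (differ refl)
differ⇒distOn-pos (false ∷ xs) (true  ∷ ys) here differ = s≤s z≤n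
differ⇒distOn-pos (true  ∷ xs) (false ∷ ys) here differ = s≤s z≤n
differ⇒distOn-pos {M = outside ∷ M} (_ ∷ xs) (_ ∷ ys) (there i∈M) differ = differ⇒distOn-pos xs ys i∈M differ
differ⇒distOn-pos {M = inside  ∷ M} (x ∷ xs) (y ∷ ys) (there i∈M) differ =
  ≤-trans (differ⇒distOn-pos xs ys i∈M differ) (m≤n+m _ (bitDistance x y))

hamming-flipBit : ∀ (u : Vec Bool n) i → hamming u (u [ i ]%= not) ≡ 1
hamming-flipBit (false ∷ u) zero    = cong suc (distOn-self ⊤ u)
hamming-flipBit (true  ∷ u) zero    = cong suc (distOn-self ⊤ u)
hamming-flipBit (x     ∷ u) (suc i) = trans (cong (_+ _) (bitDistance-self x)) (hamming-flipBit u i)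

hamming≡0⇒≡ : ∀ (u v : Vec Bool n) → hamming u v ≡ 0 → u ≡ v
hamming≡0⇒≡ []          []          _    = refl
hamming≡0⇒≡ (false ∷ u) (false ∷ v) same = cong (false ∷_) (hamming≡0⇒≡ u v same)
hamming≡0⇒≡ (true  ∷ u) (true  ∷ v) same = cong (true ∷_) (hamming≡0⇒≡ u v same)

hamming-stepTowards : ∀ {d} (u v : Vec Bool n) → hamming u v ≡ suc d →
  ∃ λ i → hamming (u [ i ]%= not) v ≡ d
hamming-stepTowards []          []          ()
hamming-stepTowards (false ∷ u) (true  ∷ v) eq = zero , suc-injective eq
hamming-stepTowards (true  ∷ u) (false ∷ v) eq = zero , suc-injective eq
hamming-stepTowards (false ∷ u) (false ∷ v) eq with hamming-stepTowards u v eq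
... | i , eq′ = suc i , eq′
hamming-stepTowards (true  ∷ u) (true  ∷ v) eq with hamming-stepTowards u v eq
... | i , eq′ = suc i , eq′

module _ {n : ℕ} where
  open Game (Q n)

  hamming≤⇒Walk : ∀ {k} (u v : Vec Bool n) → hamming u v ≤ k → Walk (λ _ → Unit.⊤) k u v
  hamming≤⇒Walk u v d≤k with hamming u v in eq
  ... | zero = subst (Walk _ _ u) (hamming≡0⇒≡ u v eq) stop
  hamming≤⇒Walk {zero}  u v ()        | suc d
  hamming≤⇒Walk {suc k} u v (s≤s d≤k) | suc d with hamming-stepTowards u v eq
  ... | i , eq′ =
    step (inj₂ (i , refl)) Unit.tt (hamming≤⇒Walk (u [ i ]%= not) v (subst (_≤ k) (sym eq′) d≤k))

  Walk⇒hamming≤ : ∀ {P k u w} → Walk P k u w → hamming u w ≤ k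
  Walk⇒hamming≤ {u = u} stop = subst (_≤ _) (sym (distOn-self ⊤ u)) z≤n
  Walk⇒hamming≤ (step (inj₁ refl) _ walk) = m≤n⇒m≤1+n (Walk⇒hamming≤ walk)
  Walk⇒hamming≤ {k = suc k} {u} {w} (step {v = v} (inj₂ (i , refl)) _ walk) = begin
    hamming u w               ≤⟨ distOn-triangle ⊤ u v w ⟩
    hamming u v + hamming v w ≡⟨ cong (_+ hamming v w) (hamming-flipBit u i) ⟩
    suc (hamming v w)         ≤⟨ s≤s (Walk⇒hamming≤ walk) ⟩
    suc k                     ∎
    where open ≤-Reasoning

  catchOrFar : ∀ s r (C : Cops k) →
    (∃ λ C′ → CopMove s C C′ × Caught C′ r) ⊎ All (λ c → s < hamming c r) C
  catchOrFar s r []      = inj₂ []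
  catchOrFar s r (c ∷ C) with ≤-<-connex (hamming c r) s
  ... | inj₁ near = inj₁ (r ∷ C , hamming≤⇒Walk c r near ∷ Pointwise.refl stop , here refl)
  ... | inj₂ far with catchOrFar s r C
  ...   | inj₁ (C′ , move , caught) = inj₁ (c ∷ C′ , stop ∷ move , there caught)
  ...   | inj₂ fars                 = inj₂ (far ∷ fars)

Decrease : Set → ℕ → ℕ → Set
Decrease P new old = new ≤ old × (P → new < old)

Decrease-+ : ∀ {P Q : Set} {a a′ b b′} →
  Dec P → Decrease P a a′ → Decrease Q b b′ → (¬ P → Q) → a + b < a′ + b′
Decrease-+ (yes p) (a≤ , a<) (b≤ , _)  _     = +-mono-<-≤ (a< p) b≤
Decrease-+ (no ¬p) (a≤ , _)  (_ , b<) ¬p⇒q = +-mono-≤-< a≤ (b< (¬p⇒q ¬p))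

m≤n+o⇒m∸p≤n : ∀ {m n o p} → o ≤ p → m ≤ n + o → m ∸ p ≤ n
m≤n+o⇒m∸p≤n {m} {n} {o} {p} o≤p m≤n+o =
  m≤n+o⇒m∸n≤o m p (≤-trans m≤n+o (≤-trans (+-monoʳ-≤ n o≤p) (≤-reflexive (+-comm n p))))

m≤o⇒m∸n<o : ∀ {m n o} → 0 < n → 0 < m → m ≤ o → m ∸ n < o
m≤o⇒m∸n<o {suc m} {suc n} _ _ m≤o = ≤-trans (s≤s (m∸n≤m m n)) m≤o

-- The guard of P chases r off P, where r agrees with its target flipOn P r.
guardMove : ℕ → Subset n → Vec Bool n → Vec Bool n → Vec Bool n
guardMove s P c r = approachOn P (s ∸ distOn (∁ P) c r) (approachOn (∁ P) s c r) (flipOn P r)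

-- Lexicographic, as the distance on P is at most ∣ P ∣ ≤ 2 < 3.
guardPotential : Subset n → Vec Bool n → Vec Bool n → ℕ
guardPotential P c r = 3 * distOn (∁ P) c r + distOn P c (flipOn P r)

guardMove-hamming : ∀ s (P : Subset n) c r → hamming c (guardMove s P c r) ≤ s
guardMove-hamming s P c r = begin
  hamming c c₂                 ≤⟨ distOn-triangle ⊤ c c₁ c₂ ⟩
  hamming c c₁ + hamming c₁ c₂ ≡⟨ cong₂ _+_ (hamming-approachOn (∁ P) s c r)
                                            (hamming-approachOn P (s ∸ e) c₁ (flipOn P r)) ⟩
  s ⊓ e + (s ∸ e) ⊓ _          ≤⟨ +-mono-≤ (≤-reflexive (⊓-comm s e)) (m⊓n≤m (s ∸ e) _) ⟩
  e ⊓ s + (s ∸ e)              ≡⟨ m⊓n+n∸m≡n e s ⟩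
  s                            ∎
  where
  open ≤-Reasoning
  e  = distOn (∁ P) c r
  c₁ = approachOn (∁ P) s c r
  c₂ = guardMove s P c r

guardMove-potential : ∀ s (P : Subset n) c r →
  guardPotential P (guardMove s P c r) r
    ≡ 3 * (distOn (∁ P) c r ∸ s) + (distOn P c (flipOn P r) ∸ (s ∸ distOn (∁ P) c r))
guardMove-potential s P c r = cong₂ (λ e i → 3 * e + i) off-P on-P
  where
  b  = s ∸ distOn (∁ P) c r
  c₁ = approachOn (∁ P) s c r
  off-P : distOn (∁ P) (guardMove s P c r) r ≡ distOn (∁ P) c r ∸ s
  off-P = trans (distOn-∁-approachOn P b c₁ (flipOn P r) r) (distOn-approachOn (∁ P) s c r)
  on-P : distOn P (guardMove s P c r) (flipOn P r) ≡ distOn P c (flipOn P r) ∸ b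
  on-P = trans (distOn-approachOn P b c₁ (flipOn P r)) (cong (_∸ b) (distOn-approachOn-∁ P s c r (flipOn P r)))

-- The letters are named as in guard-step: the guard is at distance e off P and i on P from its
-- target, the robber moves h on P and x off P, after which those distances are e′ and i′, and q
-- is the guard's distance to the robber on P.
guard-arith : ∀ {s e i h x e′ i′ q} →
  h + x ≤ s → e′ ≤ e + x → i′ ≤ i + h → h ≤ i + i′ → q + i′ ≤ 2 → s < q + e′ →
  Decrease (0 < h) (3 * (e′ ∸ s) + (i′ ∸ (s ∸ e′))) (3 * e + i)
guard-arith {s} {e} {i} {zero} {x} {e′} {i′} x≤s e′≤e+x i′≤i+0 _ _ _ =
  +-mono-≤ (*-monoʳ-≤ 3 (m≤n+o⇒m∸p≤n x≤s e′≤e+x))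
           (≤-trans (m∸n≤m i′ (s ∸ e′)) (subst (i′ ≤_) (+-identityʳ i) i′≤i+0)) ,
  λ ()
guard-arith {s} {suc e} {i} {suc h} {x} {e′} {i′} {q} h+x≤s e′≤e+x _ _ q+i′≤2 _ =
  <⇒≤ away , λ _ → away
  where
  open ≤-Reasoning
  e′∸s≤e : e′ ∸ s ≤ e
  e′∸s≤e = m≤n+o⇒m∸p≤n (≤-trans (s≤s (m≤n+m x h)) h+x≤s) (subst (e′ ≤_) (sym (+-suc e x)) e′≤e+x)
  i′∸≤2 : i′ ∸ (s ∸ e′) ≤ 2
  i′∸≤2 = ≤-trans (m∸n≤m i′ (s ∸ e′)) (≤-trans (m≤n+m i′ q) q+i′≤2)
  away : 3 * (e′ ∸ s) + (i′ ∸ (s ∸ e′)) < 3 * suc e + i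
  away = begin-strict
    3 * (e′ ∸ s) + (i′ ∸ (s ∸ e′)) ≤⟨ +-mono-≤ (*-monoʳ-≤ 3 e′∸s≤e) i′∸≤2 ⟩
    3 * e + 2                      <⟨ +-monoʳ-< (3 * e) (n<1+n 2) ⟩
    3 * e + 3                      ≡⟨ trans (+-comm (3 * e) 3) (sym (*-suc 3 e)) ⟩
    3 * suc e                      ≤⟨ m≤m+n (3 * suc e) i ⟩
    3 * suc e + i                  ∎
-- A guard level with the robber off P is out of his reach only at his antipode on P: q = 2, i′ = 0.
guard-arith {s} {zero} {i} {suc h} {x} {e′} {i′} {q} h+x≤s e′≤x _ h≤i+i′ q+i′≤2 s<q+e′ =
  <⇒≤ onTarget , λ _ → onTarget
  where
  open ≤-Reasoning
  h<q : suc h < q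
  h<q = +-cancelʳ-< x (suc h) q (begin-strict
    suc h + x ≤⟨ h+x≤s ⟩
    s         <⟨ s<q+e′ ⟩
    q + e′    ≤⟨ +-monoʳ-≤ q e′≤x ⟩
    q + x     ∎)
  i′≡0 : i′ ≡ 0
  i′≡0 = n≤0⇒n≡0 (+-cancelˡ-≤ q i′ 0 (begin
    q + i′ ≤⟨ q+i′≤2 ⟩
    2      ≤⟨ ≤-trans (s≤s (s≤s z≤n)) h<q ⟩
    q      ≡⟨ +-identityʳ q ⟨
    q + 0  ∎))
  e′∸s≡0 : e′ ∸ s ≡ 0
  e′∸s≡0 = m≤n⇒m∸n≡0 (≤-trans e′≤x (≤-trans (m≤n+m x (suc h)) h+x≤s))
  onTarget : 3 * (e′ ∸ s) + (i′ ∸ (s ∸ e′)) < 3 * zero + i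
  onTarget = begin-strict
    3 * (e′ ∸ s) + (i′ ∸ (s ∸ e′)) ≡⟨ cong₂ (λ a b → 3 * a + (b ∸ (s ∸ e′))) e′∸s≡0 i′≡0 ⟩
    0 ∸ (s ∸ e′)                   ≡⟨ 0∸n≡0 (s ∸ e′) ⟩
    0                              <⟨ s≤s z≤n ⟩
    suc h                          ≤⟨ subst (suc h ≤_) (trans (cong (i +_) i′≡0) (+-identityʳ i)) h≤i+i′ ⟩
    i                              ∎

guard-step : ∀ s (P : Subset n) c r r′ → ∣ P ∣ ≤ 2 → hamming r r′ ≤ s → s < hamming c r′ →
  Decrease (0 < distOn P r r′) (guardPotential P (guardMove s P c r′) r′) (guardPotential P c r)
guard-step s P c r r′ ∣P∣≤2 moved far =
  subst (λ new → Decrease (0 < h) new (guardPotential P c r)) (sym (guardMove-potential s P c r′))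
        (guard-arith h+x≤s e′≤e+x i′≤i+h h≤i+i′ q+i′≤2 s<q+e′)
  where
  g  = flipOn P r
  g′ = flipOn P r′
  h  = distOn P r r′
  x  = distOn (∁ P) r r′
  e  = distOn (∁ P) c r
  i  = distOn P c g
  e′ = distOn (∁ P) c r′
  i′ = distOn P c g′
  q  = distOn P c r′
  targets-moved : distOn P g g′ ≡ h
  targets-moved = distOn-flipOn-flipOn P P r r′
  h+x≤s : h + x ≤ s
  h+x≤s = subst (_≤ s) (hamming-split P r r′) moved
  e′≤e+x : e′ ≤ e + x
  e′≤e+x = distOn-triangle (∁ P) c r r′
  i′≤i+h : i′ ≤ i + h
  i′≤i+h = subst (λ h → i′ ≤ i + h) targets-moved (distOn-triangle P c g g′)
  h≤i+i′ : h ≤ i + i′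
  h≤i+i′ = subst₂ (λ h i → h ≤ i + i′) targets-moved (distOn-sym P g c) (distOn-triangle P g c g′)
  q+i′≤2 : q + i′ ≤ 2
  q+i′≤2 = subst (_≤ 2) (sym (distOn+distOn-flipOn P c r′)) ∣P∣≤2
  s<q+e′ : s < q + e′
  s<q+e′ = subst (s <_) (hamming-split P c r′) far

guardsMove : ℕ → Vec (Subset n) k → Vec (Vec Bool n) k → Vec Bool n → Vec (Vec Bool n) k
guardsMove s Ps gs r = zipWith (λ P c → guardMove s P c r) Ps gs

guardsPotential : Vec (Subset n) k → Vec (Vec Bool n) k → Vec Bool n → ℕ
guardsPotential Ps gs r = sum (zipWith (λ P c → guardPotential P c r) Ps gs)

guards-step : ∀ s (Ps : Vec (Subset n) k) gs r r′ → All (λ P → ∣ P ∣ ≤ 2) Ps → hamming r r′ ≤ s →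
  All (λ c → s < hamming c r′) gs →
  Decrease (Any (λ P → 0 < distOn P r r′) Ps)
           (guardsPotential Ps (guardsMove s Ps gs r′) r′) (guardsPotential Ps gs r)
guards-step s []       []       r r′ []           moved []           = z≤n , λ ()
guards-step s (P ∷ Ps) (c ∷ gs) r r′ (∣P∣≤2 ∷ ps) moved (far ∷ fars) =
  +-mono-≤ (proj₁ this) (proj₁ rest) ,
  λ { (here hit)  → +-mono-<-≤ (proj₂ this hit) (proj₁ rest)
    ; (there hit) → +-mono-≤-< (proj₁ this) (proj₂ rest hit) }
  where
  this = guard-step s P c r r′ ∣P∣≤2 moved far
  rest = guards-step s Ps gs r r′ ps moved fars

twinMove : ℕ → Subset n → Vec Bool n → Vec Bool n → Vec Bool n
twinMove s A c r = approachOn (∁ A) s c r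

twinMove-hamming : ∀ s (A : Subset n) c r → hamming c (twinMove s A c r) ≤ s
twinMove-hamming s A c r = subst (_≤ s) (sym (hamming-approachOn (∁ A) s c r)) (m⊓n≤m s _)

twins-arith : ∀ {s α β e} → α + β ≤ 2 * s + 1 → s < α + e → s < β + e → 0 < e
twins-arith {e = suc _} _ _ _ = s≤s z≤n
twins-arith {s} {α} {β} {zero} α+β≤ s<α s<β = ⊥-elim (<-irrefl refl (begin-strict
  2 * s + 1       <⟨ +-monoʳ-< (2 * s) (n<1+n 1) ⟩
  2 * s + 2       ≡⟨ twice-suc s ⟩
  suc s + suc s   ≤⟨ +-mono-≤ s<α s<β ⟩
  α + 0 + (β + 0) ≡⟨ cong₂ _+_ (+-identityʳ α) (+-identityʳ β) ⟩
  α + β           ≤⟨ α+β≤ ⟩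
  2 * s + 1       ∎))
  where
  open ≤-Reasoning
  twice-suc : ∀ s → 2 * s + 2 ≡ suc s + suc s
  twice-suc = solve-∀

twins-apart : ∀ s (A : Subset n) c r → ∣ A ∣ ≤ 2 * s + 1 → s < hamming c r → s < hamming (flipOn A c) r →
  0 < distOn (∁ A) c r
twins-apart s A c r ∣A∣≤ far far′ = twins-arith
  (subst (_≤ 2 * s + 1) (sym α+β≡∣A∣) ∣A∣≤)
  (subst (s <_) (hamming-split A c r) far)
  (subst (s <_) (trans (hamming-split A (flipOn A c) r) (cong (distOn A (flipOn A c) r +_) twin-off-A)) far′)
  where
  α+β≡∣A∣ : distOn A c r + distOn A (flipOn A c) r ≡ ∣ A ∣
  α+β≡∣A∣ = trans (cong₂ _+_ (distOn-sym A c r) (distOn-sym A (flipOn A c) r)) (distOn+distOn-flipOn A r c)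
  twin-off-A : distOn (∁ A) (flipOn A c) r ≡ distOn (∁ A) c r
  twin-off-A = trans (distOn-sym (∁ A) (flipOn A c) r) (trans (distOn-∁-flipOn A r c) (distOn-sym (∁ A) r c))

twins-step : ∀ s (A : Subset n) c r r′ → 0 < s → ∣ A ∣ ≤ 2 * s + 1 → hamming r r′ ≤ s →
  s < hamming c r′ → s < hamming (flipOn A c) r′ →
  Decrease (distOn (∁ A) r r′ ≡ 0) (distOn (∁ A) (twinMove s A c r′) r′) (distOn (∁ A) c r)
twins-step s A c r r′ s>0 ∣A∣≤ moved far far′ rewrite distOn-approachOn (∁ A) s c r′ =
  m≤n+o⇒m∸p≤n x≤s e′≤e+x ,
  λ x≡0 → m≤o⇒m∸n<o s>0 (twins-apart s A c r′ ∣A∣≤ far far′)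
                        (subst (distOn (∁ A) c r′ ≤_) (trans (cong (_ +_) x≡0) (+-identityʳ _)) e′≤e+x)
  where
  e′≤e+x : distOn (∁ A) c r′ ≤ distOn (∁ A) c r + distOn (∁ A) r r′
  e′≤e+x = distOn-triangle (∁ A) c r r′
  x≤s : distOn (∁ A) r r′ ≤ s
  x≤s = ≤-trans (m≤n+m _ (distOn A r r′)) (subst (_≤ s) (hamming-split A r r′) moved)

record Cover (a n m : ℕ) : Set where
  field
    block     : Subset n
    pairs     : Vec (Subset n) m
    ∣block∣≤a : ∣ block ∣ ≤ a
    ∣pairs∣≤2 : All (λ P → ∣ P ∣ ≤ 2) pairs
    covers    : ∀ {i} → i ∈ ∁ block → Any (i ∈_) pairs

fullBlock : ∀ {a b} → a ≤ b → Cover b a 0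
fullBlock {a} a≤b = record
  { block     = ⊤
  ; pairs     = []
  ; ∣block∣≤a = subst (_≤ _) (sym (∣⊤∣≡n a)) a≤b
  ; ∣pairs∣≤2 = []
  ; covers    = λ i∈∁⊤ → ⊥-elim (x∈p⇒x∉∁p ∈⊤ i∈∁⊤)
  }

addPair : ∀ {a m} → Cover a n m → Cover a (2 + n) (suc m)
addPair {n} C = record
  { block     = outside ∷ outside ∷ block
  ; pairs     = (inside ∷ inside ∷ ⊥) ∷ map (λ P → outside ∷ outside ∷ P) pairs
  ; ∣block∣≤a = ∣block∣≤a
  ; ∣pairs∣≤2 = ≤-reflexive (cong (2 +_) (∣⊥∣≡0 n)) ∷ Allₚ.map⁺ ∣pairs∣≤2
  ; covers    = λ { here               → here here
                  ; (there here)       → here (there here)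
                  ; (there (there i∈)) →
                      there (Anyₚ.map⁺ (Any.map (λ i∈P → there (there i∈P)) (covers i∈))) }
  }
  where open Cover C

pairsAndBlock : ∀ m {a b} → a ≤ b → Cover b (m * 2 + a) m
pairsAndBlock zero    a≤b = fullBlock a≤b
pairsAndBlock (suc m) a≤b = addPair (pairsAndBlock m a≤b)

module Strategy {s n m : ℕ} (s>0 : 0 < s) (cover : Cover (2 * s + 1) n m) where
  open Cover cover
  open Game (Q n)

  squad : Vec Bool n → Vec (Vec Bool n) m → Cops (2 + m)
  squad c gs = c ∷ flipOn block c ∷ gs

  squadMove : Vec Bool n → Vec (Vec Bool n) m → Vec Bool n → Cops (2 + m)
  squadMove c gs r = squad (twinMove s block c r) (guardsMove s pairs gs r)

  potential : Vec Bool n → Vec (Vec Bool n) m → Vec Bool n → ℕ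
  potential c gs r = distOn (∁ block) c r + guardsPotential pairs gs r

  pairs-hit : ∀ r r′ → 0 < distOn (∁ block) r r′ → Any (λ P → 0 < distOn P r r′) pairs
  pairs-hit r r′ left with distOn-pos⇒differ (∁ block) r r′ left
  ... | i , i∈∁block , differ = Any.map (λ i∈P → differ⇒distOn-pos r r′ i∈P differ) (covers i∈∁block)

  potential-decreases : ∀ c gs r r′ → hamming r r′ ≤ s → All (λ c → s < hamming c r′) (squad c gs) →
    potential (twinMove s block c r′) (guardsMove s pairs gs r′) r′ < potential c gs r
  potential-decreases c gs r r′ moved (far ∷ far′ ∷ fars) =
    Decrease-+ (distOn (∁ block) r r′ ≟ 0)
      (twins-step s block c r r′ s>0 ∣block∣≤a moved far far′)
      (guards-step s pairs gs r r′ ∣pairs∣≤2 moved fars)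
      (pairs-hit r r′ ∘ n≢0⇒n>0)

  guardsMove-legal : ∀ (Ps : Vec (Subset n) k) gs r → CopMove s gs (guardsMove s Ps gs r)
  guardsMove-legal []       []       r = []
  guardsMove-legal (P ∷ Ps) (c ∷ gs) r =
    hamming≤⇒Walk c _ (guardMove-hamming s P c r) ∷ guardsMove-legal Ps gs r

  squadMove-legal : ∀ c gs r → CopMove s (squad c gs) (squadMove c gs r)
  squadMove-legal c gs r =
    hamming≤⇒Walk c c′ (twinMove-hamming s block c r) ∷
    hamming≤⇒Walk (flipOn block c) (flipOn block c′)
      (subst (_≤ s) (sym (distOn-flipOn-flipOn ⊤ block c c′)) (twinMove-hamming s block c r)) ∷
    guardsMove-legal pairs gs r
    where c′ = twinMove s block c r

  -- r is where the robber stood when the squad last moved, r′ where he stands now.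
  win : ∀ N c gs r r′ → potential c gs r < N → hamming r r′ ≤ s → CopWin s (squad c gs) r′
  win N c gs r r′ bound moved with catchOrFar s r′ (squad c gs)
  ... | inj₁ (C′ , move , caught) = round C′ move (inj₁ caught)
  win zero    c gs r r′ ()    moved | inj₂ far
  win (suc N) c gs r r′ bound moved | inj₂ far =
    round (squadMove c gs r′) (squadMove-legal c gs r′) (inj₂ λ r″ flee →
      win N (twinMove s block c r′) (guardsMove s pairs gs r′) r′ r″
          (≤-trans (potential-decreases c gs r r′ moved far) (s≤s⁻¹ bound)) (Walk⇒hamming≤ flee))

  copsWin : CopsWin s (2 + m)
  copsWin = squad c₀ gs₀ , λ r →
    inj₂ (win _ c₀ gs₀ r r (n<1+n _) (subst (_≤ s) (sym (distOn-self ⊤ r)) z≤n))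
    where
    c₀  = replicate n false
    gs₀ = replicate m c₀

halve : ∀ t → ∃ λ r → r ≤ 1 × t ≡ ⌊ t /2⌋ * 2 + r
halve 0 = 0 , z≤n , refl
halve 1 = 1 , ≤-refl , refl
halve (suc (suc t)) with halve t
... | r , r≤1 , t≡ = r , r≤1 , cong (2 +_) t≡

theorem3p10 : ∀ (s d : ℕ) → 2 ≤ s → 2 ≤ d → 2 * s ≤ d →
    CopNumberLE (Q d) s ⌈ (d ∸ 2 * s) + 3 /2⌉
theorem3p10 s d 2≤s _ 2s≤d with halve (d ∸ 2 * s)
... | r , r≤1 , t≡ =
  2 + m , ≤-reflexive (cong ⌈_/2⌉ (+-comm 3 t)) ,
  subst (λ n → Game.CopsWin (Q n) s (2 + m)) (sym d≡)
        (Strategy.copsWin (<⇒≤ 2≤s) (pairsAndBlock m (+-monoʳ-≤ (2 * s) r≤1)))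
  where
  t = d ∸ 2 * s
  m = ⌊ t /2⌋
  d≡ : d ≡ m * 2 + (2 * s + r)
  d≡ = begin
    d                   ≡⟨ m+[n∸m]≡n 2s≤d ⟨
    2 * s + t           ≡⟨ cong (2 * s +_) t≡ ⟩
    2 * s + (m * 2 + r) ≡⟨ x∙yz≈y∙xz (2 * s) (m * 2) r ⟩
    m * 2 + (2 * s + r) ∎
    where open ≡-Reasoning
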